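{- Run the colouring procedure (described in the context) on an Eulerian directed multigraph $G$. Upon termination, no \textsc{Black} edges remain.
   Context: $G=(V,E)$ is a finite directed multigraph (loops and parallel edges allowed), Eulerian: strongly connected and every vertex has in-degree equal to out-degree. Colouring procedure: each edge has a colour in $\{\textsc{Black},\textsc{Red},\textsc{Green},\textsc{Dashed}\}$, initially all \textsc{Black}. Choose a start vertex $v_0$; the current vertex is $u=v_0$, and $v_0$ is marked reached. Repeat: if some \textsc{Black} edge $wu$ enters the current vertex $u$, pick one, colour it \textsc{Red} if $w$ was not yet reached (and mark $w$ reached), otherwise \textsc{Green}, and make $w$ current. Otherwise: if some \textsc{Green} edge $uw$ leaves $u$, colour it \textsc{Dashed}, output it, make $w$ current; else if $u\ne v_0$, colour the unique \textsc{Red} edge $uw$ leaving $u$ \textsc{Dashed}, output it, make $w$ current; else ($u=v_0$) terminate. -}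

module Defs where

open import Data.Nat using (ℕ)
open import Data.Fin using (Fin; _≟_)
open import Data.List using (List; length; filter)
open import Data.List.Base using (allFin)
open import Data.Bool using (Bool; true; false; if_then_else_)
open import Data.Product using (Σ; ∃; _×_; _,_)
open import Relation.Nullary using (¬_; does)
open import Relation.Binary.PropositionalEquality using (_≡_; _≢_)
open import Relation.Binary.Construct.Closure.ReflexiveTransitive using (Star)

record Multigraph : Set where
  field
    n   : ℕ
    m   : ℕ
    src : Fin m → Fin n
    tgt : Fin m → Fin n

module _ (G : Multigraph) where
  open Multigraph G

  Adj : Fin n → Fin n → Set
  Adj u v = Σ (Fin m) λ e → (src e ≡ u) × (tgt e ≡ v)

  StronglyConnected : Set
  StronglyConnected = ∀ u v → Star Adj u v

  inDegree : Fin n → ℕ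
  inDegree v = length (filter (λ e → tgt e ≟ v) (allFin m))

  outDegree : Fin n → ℕ
  outDegree v = length (filter (λ e → src e ≟ v) (allFin m))

  Eulerian : Set
  Eulerian = StronglyConnected × (∀ v → inDegree v ≡ outDegree v)

data Colour : Set where
  Black Red Green Dashed : Colour

update : ∀ {k} {A : Set} → (Fin k → A) → Fin k → A → Fin k → A
update f x a y = if does (y ≟ x) then a else f y

module Procedure (G : Multigraph) (v₀ : Fin (Multigraph.n G)) where
  open Multigraph G

  -- State of the colouring procedure (the output sequence does not influence
  -- the colouring and is omitted).
  record State : Set where
    constructor ⟨_,_,_⟩
    field
      colour  : Fin m → Colour
      reached : Fin n → Bool
      current : Fin n
  open State public

  initial : State
  initial = ⟨ (λ _ → Black) , update (λ _ → false) v₀ true , v₀ ⟩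

  NoBlackIn : State → Set
  NoBlackIn s = ∀ e → tgt e ≡ current s → colour s e ≢ Black

  NoGreenOut : State → Set
  NoGreenOut s = ∀ e → src e ≡ current s → colour s e ≢ Green

  data Step : State → State → Set where
    black-new : ∀ {s} e → colour s e ≡ Black → tgt e ≡ current s →
      reached s (src e) ≡ false →
      Step s ⟨ update (colour s) e Red , update (reached s) (src e) true , src e ⟩
    black-old : ∀ {s} e → colour s e ≡ Black → tgt e ≡ current s →
      reached s (src e) ≡ true →
      Step s ⟨ update (colour s) e Green , reached s , src e ⟩
    green-out : ∀ {s} e → NoBlackIn s → colour s e ≡ Green → src e ≡ current s →
      Step s ⟨ update (colour s) e Dashed , reached s , tgt e ⟩
    red-out : ∀ {s} e → NoBlackIn s → NoGreenOut s → current s ≢ v₀ →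
      colour s e ≡ Red → src e ≡ current s →
      Step s ⟨ update (colour s) e Dashed , reached s , tgt e ⟩

  Terminated : State → Set
  Terminated s = NoBlackIn s × NoGreenOut s × (current s ≡ v₀)

  Reachable : State → Set
  Reachable = Star Step initial

{-# OPTIONS --safe #-}
module Submission where

-- Call Red and Green edges live.  A step either makes a Black edge entering the
-- current vertex live and walks back along it, or retires a live edge leaving the
-- current vertex and walks along it; so the live edges always have the degrees of a
-- trail from the current vertex to v₀ (Balanced).  Hence if the walk stands at a
-- vertex u with no Black edge entering it and exactly one way out (a single live
-- out-edge, or u = v₀ with none), no live edge enters u: every edge into u is
-- Dashed.  This happens to v₀ at termination, and to every other vertex when it is
-- left along its red edge.  The red edges, retired or not, lead from every reached
-- vertex to v₀, so "all in-edges Dashed" spreads from v₀ to every reached vertex,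
-- and by strong connectivity every vertex is reached.

open import Defs
open import Data.Nat.Properties
  using (+-0-commutativeMonoid; +-commutativeSemigroup; +-identityʳ; +-cancelʳ-≡;
         *-identityˡ; *-identityʳ; *-zeroʳ; m+n≡0⇒m≡0)
open import Algebra.Properties.CommutativeMonoid.Sum +-0-commutativeMonoid
  using (sum; sum-remove; sum-cong-≗; sum-replicate-zero)
open import Algebra.Properties.CommutativeSemigroup +-commutativeSemigroup
  using (xy∙z≈xz∙y; xy∙z≈zy∙x)
open import Data.Bool using (Bool; true; false)
open import Data.Fin using (Fin; _≟_; punchIn)
open import Data.Fin.Properties using (punchInᵢ≢i)
open import Data.Nat using (ℕ; suc; _+_; _*_)
open import Data.Product as Prod using (_×_; _,_; proj₁; proj₂)
open import Data.Sum using (_⊎_; inj₁; inj₂)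
open import Data.Vec.Functional using (removeAt)
open import Function using (_∘_; id)
open import Relation.Binary.Construct.Closure.ReflexiveTransitive as Star
  using (Star; ε; _◅_; fold)
open import Relation.Binary.PropositionalEquality
  using (_≡_; _≢_; refl; sym; trans; cong; cong₂; subst; module ≡-Reasoning)
open import Relation.Nullary using (yes; no; contradiction)
open ≡-Reasoning

module _ {A : Set} {R : A → A → Set} (P : A → Set) where

  Star-induction : (∀ {a b} → R a b → P a → P b) → ∀ {x y} → Star R x y → P x → P y
  Star-induction step = fold (λ a b → P a → P b) (λ r k → k ∘ step r) id

  Star-backward-induction : (∀ {a b} → R a b → P b → P a) → ∀ {x y} → Star R x y → P y → P x
  Star-backward-induction step = fold (λ a b → P b → P a) (λ r k → step r ∘ k) id

module _ {k : ℕ} {A : Set} where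

  update-same : (f : Fin k → A) (x : Fin k) (a : A) → update f x a x ≡ a
  update-same f x a with x ≟ x
  ... | yes _   = refl
  ... | no x≢x = contradiction refl x≢x

  update-other : (f : Fin k → A) {x y : Fin k} (a : A) → y ≢ x → update f x a y ≡ f y
  update-other f {x} {y} a y≢x with y ≟ x
  ... | yes y≡x = contradiction y≡x y≢x
  ... | no _    = refl

  update-elim : (P : Fin k → A → Set) {f : Fin k → A} {x : Fin k} {a : A} →
    P x a → (∀ y → y ≢ x → P y (f y)) → ∀ y → P y (update f x a y)
  update-elim P {x = x} Px Pf y with y ≟ x
  ... | yes refl = Px
  ... | no y≢x   = Pf y y≢x

δ : ∀ {k} → Fin k → Fin k → ℕ
δ u = update (λ _ → 0) u 1

δ-same : ∀ {k} {u z : Fin k} → u ≡ z → δ u z ≡ 1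
δ-same {u = u} refl = update-same _ u 1

δ-other : ∀ {k} {u z : Fin k} → u ≢ z → δ u z ≡ 0
δ-other u≢z = update-other _ 1 (u≢z ∘ sym)

sum-update : ∀ {k} (f g : Fin k → ℕ) x → (∀ y → y ≢ x → f y ≡ g y) → sum f + g x ≡ sum g + f x
sum-update {suc k} f g x f≐g = begin
  sum f + g x                     ≡⟨ cong (_+ g x) (sum-remove {i = x} f) ⟩
  f x + sum (removeAt f x) + g x  ≡⟨ cong (λ t → f x + t + g x) (sum-cong-≗ λ i →
                                       f≐g (punchIn x i) (punchInᵢ≢i x i)) ⟩
  f x + sum (removeAt g x) + g x  ≡⟨ xy∙z≈zy∙x (f x) _ (g x) ⟩
  g x + sum (removeAt g x) + f x  ≡⟨ cong (_+ f x) (sym (sum-remove {i = x} g)) ⟩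
  sum g + f x                     ∎

sum≡0⇒≡0 : ∀ {k} (f : Fin k → ℕ) → sum f ≡ 0 → ∀ x → f x ≡ 0
sum≡0⇒≡0 {suc k} f Σf≡0 x = m+n≡0⇒m≡0 (f x) (trans (sym (sum-remove {i = x} f)) Σf≡0)

live : Colour → ℕ
live Black  = 0
live Red    = 1
live Green  = 1
live Dashed = 0

live≡0 : ∀ {c} → c ≢ Red → c ≢ Green → live c ≡ 0
live≡0 {Black}  _ _ = refl
live≡0 {Red}    c≢R _ = contradiction refl c≢R
live≡0 {Green}  _ c≢G = contradiction refl c≢G
live≡0 {Dashed} _ _ = refl

live≡0⇒Dashed : ∀ {c} → live c ≡ 0 → c ≢ Black → c ≡ Dashed
live≡0⇒Dashed {Black}  _ c≢B = contradiction refl c≢B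
live≡0⇒Dashed {Dashed} _ _ = refl

fresh≢reached : ∀ {k} (r : Fin k → Bool) {a b} → r a ≡ false → r b ≡ true → a ≢ b
fresh≢reached _ ra≡false rb≡true refl with trans (sym ra≡false) rb≡true
... | ()

module ProcedureProperties (G : Multigraph) (v₀ : Fin (Multigraph.n G)) where
  open Multigraph G
  open Procedure G v₀

  liveDegree : (Fin m → Colour) → (Fin m → Fin n) → Fin n → ℕ
  liveDegree κ end z = sum λ x → live (κ x) * δ (end x) z

  -- The degree condition for the live edges to form a trail from u to v₀.
  Balanced : (Fin m → Colour) → Fin n → Set
  Balanced κ u = ∀ z → liveDegree κ src z + δ v₀ z ≡ liveDegree κ tgt z + δ u z

  AllInDashed : (Fin m → Colour) → Fin n → Set
  AllInDashed κ z = ∀ x → tgt x ≡ z → κ x ≡ Dashed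

  data TreeEdge (κ : Fin m → Colour) : Fin n → Fin n → Set where
    red     : ∀ p → κ p ≡ Red → TreeEdge κ (src p) (tgt p)
    retired : ∀ p → κ p ≡ Dashed → AllInDashed κ (src p) → TreeEdge κ (src p) (tgt p)

  TreePath : (Fin m → Colour) → Fin n → Set
  TreePath κ z = Star (TreeEdge κ) z v₀

  liveDegree-update : ∀ κ e c end z →
    liveDegree (update κ e c) end z + live (κ e) * δ (end e) z ≡
    liveDegree κ end z + live c * δ (end e) z
  liveDegree-update κ e c end z = trans
    (sum-update _ _ e λ x x≢e → cong (λ c′ → live c′ * δ (end x) z) (update-other κ c x≢e))
    (cong (λ c′ → liveDegree κ end z + live c′ * δ (end e) z) (update-same κ e c))

  liveDegree-activate : ∀ {κ e c} end z → κ e ≡ Black → live c ≡ 1 →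
    liveDegree (update κ e c) end z ≡ liveDegree κ end z + δ (end e) z
  liveDegree-activate {κ} {e} {c} end z κe≡B live-c≡1 = begin
    D′                           ≡⟨ sym (+-identityʳ D′) ⟩
    D′ + 0                       ≡⟨ cong (λ c′ → D′ + live c′ * d) (sym κe≡B) ⟩
    D′ + live (κ e) * d          ≡⟨ liveDegree-update κ e c end z ⟩
    D + live c * d               ≡⟨ cong (λ l → D + l * d) live-c≡1 ⟩
    D + 1 * d                    ≡⟨ cong (D +_) (*-identityˡ d) ⟩
    D + d                        ∎
    where
    D D′ d : ℕ
    D  = liveDegree κ end z
    D′ = liveDegree (update κ e c) end z
    d  = δ (end e) z

  liveDegree-retire : ∀ {κ e} end z → live (κ e) ≡ 1 →
    liveDegree κ end z ≡ liveDegree (update κ e Dashed) end z + δ (end e) z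
  liveDegree-retire {κ} {e} end z live-κe≡1 = begin
    D                            ≡⟨ sym (+-identityʳ D) ⟩
    D + live Dashed * d          ≡⟨ sym (liveDegree-update κ e Dashed end z) ⟩
    D′ + live (κ e) * d          ≡⟨ cong (λ l → D′ + l * d) live-κe≡1 ⟩
    D′ + 1 * d                   ≡⟨ cong (D′ +_) (*-identityˡ d) ⟩
    D′ + d                       ∎
    where
    D D′ d : ℕ
    D  = liveDegree κ end z
    D′ = liveDegree (update κ e Dashed) end z
    d  = δ (end e) z

  balanced-activate : ∀ {κ e c u} → κ e ≡ Black → live c ≡ 1 → tgt e ≡ u →
    Balanced κ u → Balanced (update κ e c) (src e)
  balanced-activate {κ} {e} {c} κe≡B live-c≡1 refl balanced z = begin
    liveDegree κ′ src z + δ v₀ z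
      ≡⟨ cong (_+ δ v₀ z) (liveDegree-activate src z κe≡B live-c≡1) ⟩
    liveDegree κ src z + δ (src e) z + δ v₀ z
      ≡⟨ xy∙z≈xz∙y (liveDegree κ src z) _ _ ⟩
    liveDegree κ src z + δ v₀ z + δ (src e) z
      ≡⟨ cong (_+ δ (src e) z) (balanced z) ⟩
    liveDegree κ tgt z + δ (tgt e) z + δ (src e) z
      ≡⟨ cong (_+ δ (src e) z) (liveDegree-activate tgt z κe≡B live-c≡1) ⟨
    liveDegree κ′ tgt z + δ (src e) z
      ∎
    where
    κ′ : Fin m → Colour
    κ′ = update κ e c

  balanced-retire : ∀ {κ e u} → live (κ e) ≡ 1 → src e ≡ u →
    Balanced κ u → Balanced (update κ e Dashed) (tgt e)
  balanced-retire {κ} {e} live-κe≡1 refl balanced z = +-cancelʳ-≡ (δ (src e) z) _ _ (begin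
    liveDegree κ′ src z + δ v₀ z + δ (src e) z
      ≡⟨ xy∙z≈xz∙y (liveDegree κ′ src z) _ _ ⟩
    liveDegree κ′ src z + δ (src e) z + δ v₀ z
      ≡⟨ cong (_+ δ v₀ z) (liveDegree-retire src z live-κe≡1) ⟨
    liveDegree κ src z + δ v₀ z
      ≡⟨ balanced z ⟩
    liveDegree κ tgt z + δ (src e) z
      ≡⟨ cong (_+ δ (src e) z) (liveDegree-retire tgt z live-κe≡1) ⟩
    liveDegree κ′ tgt z + δ (tgt e) z + δ (src e) z
      ∎)
    where
    κ′ : Fin m → Colour
    κ′ = update κ e Dashed

  liveDegree≡0 : ∀ κ end z → (∀ x → end x ≡ z → live (κ x) ≡ 0) → liveDegree κ end z ≡ 0
  liveDegree≡0 κ end z dead = trans (sum-cong-≗ term≡0) (sum-replicate-zero m)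
    where
    term≡0 : ∀ x → live (κ x) * δ (end x) z ≡ 0
    term≡0 x with end x ≟ z
    ... | yes ex≡z = cong (_* δ (end x) z) (dead x ex≡z)
    ... | no ex≢z  = trans (cong (live (κ x) *_) (δ-other ex≢z)) (*-zeroʳ (live (κ x)))

  liveDegree≡0⇒dead : ∀ κ end z → liveDegree κ end z ≡ 0 → ∀ x → end x ≡ z → live (κ x) ≡ 0
  liveDegree≡0⇒dead κ end z degree≡0 x ex≡z = begin
    live (κ x)                   ≡⟨ sym (*-identityʳ (live (κ x))) ⟩
    live (κ x) * 1               ≡⟨ cong (live (κ x) *_) (sym (δ-same ex≡z)) ⟩
    live (κ x) * δ (end x) z     ≡⟨ sum≡0⇒≡0 _ degree≡0 x ⟩
    0                            ∎

  allInDashed-at-exit : ∀ {κ u} → Balanced κ u → liveDegree κ src u + δ v₀ u ≡ 1 →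
    (∀ x → tgt x ≡ u → κ x ≢ Black) → AllInDashed κ u
  allInDashed-at-exit {κ} {u} balanced exits≡1 noBlackIn x tx≡u =
    live≡0⇒Dashed (liveDegree≡0⇒dead κ tgt u liveIn≡0 x tx≡u) (noBlackIn x tx≡u)
    where
    liveIn≡0 : liveDegree κ tgt u ≡ 0
    liveIn≡0 = +-cancelʳ-≡ 1 _ 0 (begin
      liveDegree κ tgt u + 1     ≡⟨ cong (liveDegree κ tgt u +_) (sym (δ-same {u = u} refl)) ⟩
      liveDegree κ tgt u + δ u u ≡⟨ sym (balanced u) ⟩
      liveDegree κ src u + δ v₀ u ≡⟨ exits≡1 ⟩
      1                          ∎)

  colour-stays : ∀ (κ : Fin m → Colour) e c x {c₀ c₁} → κ e ≡ c₀ → c₀ ≢ c₁ →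
    κ x ≡ c₁ → update κ e c x ≡ c₁
  colour-stays κ e c x {c₀} {c₁} κe≡c₀ c₀≢c₁ = update-elim (λ y c′ → κ y ≡ c₁ → c′ ≡ c₁)
    (λ κe≡c₁ → contradiction (trans (sym κe≡c₀) κe≡c₁) c₀≢c₁) (λ _ _ → id) x

  allInDashed-stays : ∀ (κ : Fin m → Colour) {e z} c {c₀} → κ e ≡ c₀ → c₀ ≢ Dashed →
    AllInDashed κ z → AllInDashed (update κ e c) z
  allInDashed-stays κ {e} c κe≡c₀ c₀≢D allIn x tx≡z = colour-stays κ e c x κe≡c₀ c₀≢D (allIn x tx≡z)

  treeEdge-recolour : ∀ {κ e c₀ z w} c → κ e ≡ c₀ → c₀ ≢ Red → c₀ ≢ Dashed →
    TreeEdge κ z w → TreeEdge (update κ e c) z w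
  treeEdge-recolour {κ} {e} c κe≡c₀ c₀≢R _ (red p κp≡R) =
    red p (colour-stays κ e c p κe≡c₀ c₀≢R κp≡R)
  treeEdge-recolour {κ} {e} c κe≡c₀ _ c₀≢D (retired p κp≡D allIn) =
    retired p (colour-stays κ e c p κe≡c₀ c₀≢D κp≡D) (allInDashed-stays κ c κe≡c₀ c₀≢D allIn)

  treeEdge-retire : ∀ {κ e z w} → κ e ≡ Red → AllInDashed κ (src e) →
    TreeEdge κ z w → TreeEdge (update κ e Dashed) z w
  treeEdge-retire {κ} {e} κe≡R allIn-e (red p κp≡R) with p ≟ e
  ... | yes refl =
    retired p (update-same κ p Dashed) (allInDashed-stays κ Dashed κe≡R (λ ()) allIn-e)
  ... | no p≢e   = red p (trans (update-other κ {e} {p} Dashed p≢e) κp≡R)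
  treeEdge-retire {κ} {e} κe≡R allIn-e (retired p κp≡D allIn) =
    retired p (colour-stays κ e Dashed p κe≡R (λ ()) κp≡D)
              (allInDashed-stays κ Dashed κe≡R (λ ()) allIn)

  treeEdge-settles : ∀ {κ z w} → TreeEdge κ z w → AllInDashed κ w → AllInDashed κ z
  treeEdge-settles (red p κp≡R) allIn-w with trans (sym (allIn-w p refl)) κp≡R
  ... | ()
  treeEdge-settles (retired p _ allIn) _ = allIn

  EndsReached : (Fin n → Bool) → Fin m → Colour → Set
  EndsReached r x c = c ≢ Black → r (src x) ≡ true × r (tgt x) ≡ true

  record Invariant (s : State) : Set where
    field
      root-reached      : reached s v₀ ≡ true
      current-reached   : reached s (current s) ≡ true
      used-reached      : ∀ x → EndsReached (reached s) x (colour s x)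
      red-not-from-root : ∀ x → colour s x ≡ Red → src x ≢ v₀
      red-unique        : ∀ x y → colour s x ≡ Red → colour s y ≡ Red → src x ≡ src y → x ≡ y
      balanced          : Balanced (colour s) (current s)
      tree-paths        : ∀ z → reached s z ≡ true → TreePath (colour s) z
  open Invariant

  ends-reached : ∀ {s x c} → Invariant s → colour s x ≡ c → c ≢ Black →
    reached s (src x) ≡ true × reached s (tgt x) ≡ true
  ends-reached {x = x} I refl = used-reached I x

  target-reached : ∀ {s e} → Invariant s → tgt e ≡ current s → reached s (tgt e) ≡ true
  target-reached {s} I te = subst (λ v → reached s v ≡ true) (sym te) (current-reached I)

  was-red : ∀ (κ : Fin m → Colour) {e c} → c ≢ Red → ∀ x → update κ e c x ≡ Red → κ x ≡ Red
  was-red κ c≢R =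
    update-elim (λ x c′ → c′ ≡ Red → κ x ≡ Red) (λ c≡R → contradiction c≡R c≢R) (λ _ _ → id)

  red-or-new : ∀ (κ : Fin m → Colour) {e c} x → update κ e c x ≡ Red → x ≡ e ⊎ κ x ≡ Red
  red-or-new κ {e} =
    update-elim (λ x c′ → c′ ≡ Red → x ≡ e ⊎ κ x ≡ Red) (λ _ → inj₁ refl) (λ _ _ → inj₂)

  invariant-initial : Invariant initial
  invariant-initial = record
    { root-reached      = update-same _ v₀ true
    ; current-reached   = update-same _ v₀ true
    ; used-reached      = λ _ Black≢Black → contradiction refl Black≢Black
    ; red-not-from-root = λ _ ()
    ; red-unique        = λ _ _ ()
    ; balanced          = λ _ → refl
    ; tree-paths        =
        update-elim (λ z b → b ≡ true → TreePath (λ _ → Black) z) (λ _ → ε) (λ _ _ ())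
    }

  reached-mono : ∀ {s s′} → Step s s′ → ∀ {z} → reached s z ≡ true → reached s′ z ≡ true
  reached-mono {s} (black-new e _ _ _) {z} =
    update-elim (λ y b → reached s y ≡ true → b ≡ true) (λ _ → refl) (λ _ _ → id) z
  reached-mono (black-old _ _ _ _)     = id
  reached-mono (green-out _ _ _ _)     = id
  reached-mono (red-out _ _ _ _ _ _)   = id

  current-reached-step : ∀ {s s′} → Invariant s → Step s s′ → reached s′ (current s′) ≡ true
  current-reached-step {s} I (black-new e _ _ _)   = update-same (reached s) (src e) true
  current-reached-step I (black-old _ _ _ src-reached) = src-reached
  current-reached-step I (green-out _ _ κe≡G _)    = proj₂ (ends-reached I κe≡G λ ())
  current-reached-step I (red-out _ _ _ _ κe≡R _)  = proj₂ (ends-reached I κe≡R λ ())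

  used-reached-step : ∀ {s s′} → Invariant s → Step s s′ →
    ∀ x → EndsReached (reached s′) x (colour s′ x)
  used-reached-step {s} I st@(black-new e _ te _) =
    update-elim (EndsReached (update (reached s) (src e) true))
    (λ _ → update-same (reached s) (src e) true , reached-mono st (target-reached I te))
    (λ y _ → Prod.map (reached-mono st) (reached-mono st) ∘ used-reached I y)
  used-reached-step {s} I (black-old _ _ te src-reached) =
    update-elim (EndsReached (reached s))
    (λ _ → src-reached , target-reached I te) (λ y _ → used-reached I y)
  used-reached-step {s} I (green-out _ _ κe≡G _) =
    update-elim (EndsReached (reached s))
    (λ _ → ends-reached I κe≡G λ ()) (λ y _ → used-reached I y)
  used-reached-step {s} I (red-out _ _ _ _ κe≡R _) =
    update-elim (EndsReached (reached s))
    (λ _ → ends-reached I κe≡R λ ()) (λ y _ → used-reached I y)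

  red-not-from-root-step : ∀ {s s′} → Invariant s → Step s s′ →
    ∀ x → colour s′ x ≡ Red → src x ≢ v₀
  red-not-from-root-step {s} I (black-new _ _ _ fresh) =
    update-elim (λ x c → c ≡ Red → src x ≢ v₀)
    (λ _ → fresh≢reached (reached s) fresh (root-reached I)) (λ y _ → red-not-from-root I y)
  red-not-from-root-step {s} I (black-old _ _ _ _) x =
    red-not-from-root I x ∘ was-red (colour s) (λ ()) x
  red-not-from-root-step {s} I (green-out _ _ _ _) x =
    red-not-from-root I x ∘ was-red (colour s) (λ ()) x
  red-not-from-root-step {s} I (red-out _ _ _ _ _ _) x =
    red-not-from-root I x ∘ was-red (colour s) (λ ()) x

  red-unique-step : ∀ {s s′} → Invariant s → Step s s′ →
    ∀ x y → colour s′ x ≡ Red → colour s′ y ≡ Red → src x ≡ src y → x ≡ y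
  red-unique-step {s} I (black-new _ _ _ fresh) x y κ′x≡R κ′y≡R sx≡sy
    with red-or-new (colour s) x κ′x≡R | red-or-new (colour s) y κ′y≡R
  ... | inj₁ refl | inj₁ refl = refl
  ... | inj₁ refl | inj₂ κy≡R =
    contradiction sx≡sy (fresh≢reached (reached s) fresh (proj₁ (ends-reached I κy≡R λ ())))
  ... | inj₂ κx≡R | inj₁ refl =
    contradiction (sym sx≡sy) (fresh≢reached (reached s) fresh (proj₁ (ends-reached I κx≡R λ ())))
  ... | inj₂ κx≡R | inj₂ κy≡R = red-unique I x y κx≡R κy≡R sx≡sy
  red-unique-step {s} I (black-old _ _ _ _) x y κ′x≡R κ′y≡R =
    red-unique I x y (was-red (colour s) (λ ()) x κ′x≡R) (was-red (colour s) (λ ()) y κ′y≡R)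
  red-unique-step {s} I (green-out _ _ _ _) x y κ′x≡R κ′y≡R =
    red-unique I x y (was-red (colour s) (λ ()) x κ′x≡R) (was-red (colour s) (λ ()) y κ′y≡R)
  red-unique-step {s} I (red-out _ _ _ _ _ _) x y κ′x≡R κ′y≡R =
    red-unique I x y (was-red (colour s) (λ ()) x κ′x≡R) (was-red (colour s) (λ ()) y κ′y≡R)

  balanced-step : ∀ {s s′} → Invariant s → Step s s′ → Balanced (colour s′) (current s′)
  balanced-step I (black-new _ κe≡B te _)     = balanced-activate κe≡B refl te (balanced I)
  balanced-step I (black-old _ κe≡B te _)     = balanced-activate κe≡B refl te (balanced I)
  balanced-step I (green-out _ _ κe≡G se)     = balanced-retire (cong live κe≡G) se (balanced I)
  balanced-step I (red-out _ _ _ _ κe≡R se)   = balanced-retire (cong live κe≡R) se (balanced I)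

  red-exit-settles : ∀ {s e} → Invariant s → NoBlackIn s → NoGreenOut s → current s ≢ v₀ →
    colour s e ≡ Red → src e ≡ current s → AllInDashed (colour s) (current s)
  red-exit-settles {s} {e} I noBlackIn noGreenOut current≢v₀ κe≡R se =
    allInDashed-at-exit (balanced I) exits≡1 noBlackIn
    where
    u : Fin n
    u = current s
    κ′ : Fin m → Colour
    κ′ = update (colour s) e Dashed
    liveOut′≡0 : liveDegree κ′ src u ≡ 0
    liveOut′≡0 = liveDegree≡0 κ′ src u (update-elim (λ x c → src x ≡ u → live c ≡ 0) (λ _ → refl)
      λ y y≢e sy≡u → live≡0 (λ κy≡R → y≢e (red-unique I y e κy≡R κe≡R (trans sy≡u (sym se))))
                            (noGreenOut y sy≡u))
    exits≡1 : liveDegree (colour s) src u + δ v₀ u ≡ 1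
    exits≡1 = begin
      liveDegree (colour s) src u + δ v₀ u
        ≡⟨ cong (_+ δ v₀ u) (liveDegree-retire src u (cong live κe≡R)) ⟩
      liveDegree κ′ src u + δ (src e) u + δ v₀ u
        ≡⟨ cong₂ (λ a b → a + b + δ v₀ u) liveOut′≡0 (δ-same se) ⟩
      1 + δ v₀ u
        ≡⟨ cong (1 +_) (δ-other (current≢v₀ ∘ sym)) ⟩
      1
        ∎

  tree-paths-step : ∀ {s s′} → Invariant s → Step s s′ →
    ∀ z → reached s′ z ≡ true → TreePath (colour s′) z
  tree-paths-step {s} I (black-new e κe≡B te _) =
    update-elim (λ z b → b ≡ true → TreePath κ′ z)
      (λ _ → red e (update-same (colour s) e Red)
               ◅ keep (tree-paths I (tgt e) (target-reached I te)))
      (λ z _ → keep ∘ tree-paths I z)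
    where
    κ′ : Fin m → Colour
    κ′ = update (colour s) e Red
    keep : ∀ {z} → TreePath (colour s) z → TreePath κ′ z
    keep = Star.map (treeEdge-recolour Red κe≡B (λ ()) (λ ()))
  tree-paths-step I (black-old _ κe≡B _ _) z =
    Star.map (treeEdge-recolour Green κe≡B (λ ()) (λ ())) ∘ tree-paths I z
  tree-paths-step I (green-out _ _ κe≡G _) z =
    Star.map (treeEdge-recolour Dashed κe≡G (λ ()) (λ ())) ∘ tree-paths I z
  tree-paths-step {s} I (red-out e noBlackIn noGreenOut current≢v₀ κe≡R se) z =
    Star.map (treeEdge-retire κe≡R settled) ∘ tree-paths I z
    where
    settled : AllInDashed (colour s) (src e)
    settled = subst (AllInDashed (colour s)) (sym se)
                (red-exit-settles I noBlackIn noGreenOut current≢v₀ κe≡R se)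

  invariant-step : ∀ {s s′} → Step s s′ → Invariant s → Invariant s′
  invariant-step st I = record
    { root-reached      = reached-mono st (root-reached I)
    ; current-reached   = current-reached-step I st
    ; used-reached      = used-reached-step I st
    ; red-not-from-root = red-not-from-root-step I st
    ; red-unique        = red-unique-step I st
    ; balanced          = balanced-step I st
    ; tree-paths        = tree-paths-step I st
    }

  invariant-reachable : ∀ {s} → Reachable s → Invariant s
  invariant-reachable run = Star-induction Invariant invariant-step run invariant-initial

  root-settles : ∀ {s} → Invariant s → Terminated s → AllInDashed (colour s) v₀
  root-settles {s} I (noBlackIn , noGreenOut , current≡v₀) =
    subst (AllInDashed (colour s)) current≡v₀ (allInDashed-at-exit (balanced I) exits≡1 noBlackIn)
    where
    exits≡1 : liveDegree (colour s) src (current s) + δ v₀ (current s) ≡ 1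
    exits≡1 = cong₂ _+_
      (liveDegree≡0 (colour s) src (current s) λ x sx≡current →
        live≡0 (λ κx≡R → red-not-from-root I x κx≡R (trans sx≡current current≡v₀))
               (noGreenOut x sx≡current))
      (δ-same (sym current≡v₀))

  all-settled : ∀ {s} → Invariant s → Terminated s →
    ∀ z → reached s z ≡ true → AllInDashed (colour s) z
  all-settled {s} I terminated z z-reached =
    Star-backward-induction (AllInDashed (colour s)) treeEdge-settles
      (tree-paths I z z-reached) (root-settles I terminated)

  all-reached : ∀ {s} → StronglyConnected G → Invariant s → Terminated s → ∀ z → reached s z ≡ true
  all-reached {s} connected I terminated z =
    Star-backward-induction (λ v → reached s v ≡ true) source-reached
      (connected z v₀) (root-reached I)
    where
    source-reached : ∀ {a b} → Adj G a b → reached s b ≡ true → reached s a ≡ true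
    source-reached (x , refl , refl) b-reached =
      proj₁ (ends-reached I (all-settled I terminated _ b-reached x refl) λ ())

  all-dashed : ∀ {s} → StronglyConnected G → Invariant s → Terminated s → ∀ e → colour s e ≡ Dashed
  all-dashed connected I terminated e =
    all-settled I terminated (tgt e) (all-reached connected I terminated (tgt e)) e refl

lemma9 : (G : Multigraph) → Eulerian G → (v₀ : Fin (Multigraph.n G)) →
    (s : Procedure.State G v₀) → Procedure.Reachable G v₀ s →
    Procedure.Terminated G v₀ s →
    ∀ e → Procedure.State.colour s e ≢ Black
lemma9 G (connected , _) v₀ s run terminated e =
  subst (_≢ Black) (sym (all-dashed connected (invariant-reachable run) terminated e)) λ ()
  where
  open ProcedureProperties G v₀
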